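{- Let $G$ be a graph on $n$ vertices and let $j,r$ be positive integers. Let $p=p_r(G)$. Then \[ \sum_{S\in V(G)^j}|N(S)|^r\geq n^{j+r}p^{jr}. \] If $p>4jn^{ -1/r}$, then \[ \sum_{S\in V(G)_j}|N(S)|^r\geq\frac{1}{2^{j+1}}\,n^{j+r}p^{jr}. \]
   Context: All graphs are finite simple graphs. For a positive integer $r$, $p_r(G)=t_{K_{1,r}}(G)^{1/r}$ where $t_{K_{1,r}}(G)=\frac{1}{|G|^{r+1}}\sum_{v\in V(G)}d(v)^r$. $V(G)^j$ denotes the set of all sequences of length $j$ of vertices of $G$ (repetitions allowed), and $V(G)_j$ the set of such sequences whose $j$ terms are pairwise distinct. For a sequence $S$, $N(S)$ is the set of vertices adjacent to every vertex of $S$. -}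

module Defs where

open import Data.Bool using (Bool; true; false; if_then_else_; not; _∧_)
import Data.Bool
open import Data.Nat using (ℕ; zero; suc; _+_; _*_; _^_)
open import Data.Fin using (Fin; _≟_)
open import Data.List using (List; []; _∷_; [_]; map; concatMap; allFin; filter)
open import Data.Nat.ListAction using (sum)
open import Data.Vec using (Vec; []; _∷_)
open import Relation.Nullary.Decidable using (⌊_⌋)
open import Relation.Binary.PropositionalEquality using (_≡_)

record Graph (n : ℕ) : Set where
  field
    adj   : Fin n → Fin n → Bool
    adj-sym : ∀ u v → adj u v ≡ adj v u
    adj-irr : ∀ v → adj v v ≡ false
open Graph public

count : {n : ℕ} → (Fin n → Bool) → ℕ
count {n} f = sum (map (λ v → if f v then 1 else 0) (allFin n))

degree : {n : ℕ} → Graph n → Fin n → ℕ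
degree G v = count (λ w → adj G v w)

-- sum over v of d(v)^r  (so t_{K_{1,r}}(G) = degPowSum G r / n^(r+1))
degPowSum : {n : ℕ} → Graph n → ℕ → ℕ
degPowSum {n} G r = sum (map (λ v → degree G v ^ r) (allFin n))

adjAll : {n j : ℕ} → Graph n → Vec (Fin n) j → Fin n → Bool
adjAll G [] w = true
adjAll G (s ∷ S) w = adj G s w ∧ adjAll G S w

commonNbrs : {n j : ℕ} → Graph n → Vec (Fin n) j → ℕ
commonNbrs G S = count (adjAll G S)

allSeqs : (n j : ℕ) → List (Vec (Fin n) j)
allSeqs n zero = [ [] ]
allSeqs n (suc j) = concatMap (λ v → map (v ∷_) (allSeqs n j)) (allFin n)

notIn : {n j : ℕ} → Fin n → Vec (Fin n) j → Bool
notIn x [] = true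
notIn x (y ∷ ys) = not ⌊ x ≟ y ⌋ ∧ notIn x ys

distinct : {n j : ℕ} → Vec (Fin n) j → Bool
distinct [] = true
distinct (x ∷ xs) = notIn x xs ∧ distinct xs

distinctSeqs : (n j : ℕ) → List (Vec (Fin n) j)
distinctSeqs n j = filter (λ S → distinct S Data.Bool.≟ true) (allSeqs n j)

seqSum : {n : ℕ} → Graph n → (j r : ℕ) → ℕ
seqSum {n} G j r = sum (map (λ S → commonNbrs G S ^ r) (allSeqs n j))

distinctSeqSum : {n : ℕ} → Graph n → (j r : ℕ) → ℕ
distinctSeqSum {n} G j r = sum (map (λ S → commonNbrs G S ^ r) (distinctSeqs n j))

-- Double counting turns Σ_{S ∈ V^j} |N(S)|^r into Σ_{T ∈ V^r} |N(T)|^j, and Σ_v d(v)^r into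
-- Σ_{T ∈ V^r} |N(T)|.  The power-mean inequality over the n^r sequences T then gives the first
-- bound.  For the second, a set of size x contains at least (x − j)^j sequences of j distinct
-- elements; under the hypothesis on p the truncation by j costs at most half of Σ_T |N(T)|,
-- whence the factor 2^j (and the statement's 2^(j+1)).
module Submission where

open import Defs
open import Algebra.Bundles using (CommutativeMonoid)
open import Data.Bool using (Bool; true; false; if_then_else_; not; _∧_)
import Data.Bool
open import Data.Bool.Properties using (∧-assoc; ∧-comm; ∧-identityʳ; ∧-commutativeMonoid)
open import Algebra.Properties.CommutativeSemigroup
  (CommutativeMonoid.commutativeSemigroup ∧-commutativeMonoid)
  using () renaming (interchange to ∧-interchange)
open import Data.Nat using (ℕ; zero; suc; _+_; _*_; _^_; _∸_; _≤_; _<_; _≤?_; z≤n; s≤s; NonZero)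
open import Data.Nat.Properties hiding (_≟_)
open import Data.Nat.ListAction using (sum)
open import Data.Nat.ListAction.Properties using (sum-++)
open import Data.Nat.Tactic.RingSolver using (solve-∀)
open import Data.Fin using (Fin; _≟_) renaming (zero to fzero; suc to fsuc)
open import Data.List using (List; []; _∷_; map; concatMap; filter; length; allFin; _++_)
open import Data.List.Properties using (map-++; map-tabulate; length-tabulate)
open import Data.Vec using (Vec; []; _∷_)
open import Data.Product using (_×_; _,_)
open import Data.Sum using (inj₁; inj₂)
open import Function using (id)
open import Relation.Binary.Definitions using (Monotonic₁)
open import Relation.Binary.PropositionalEquality
  using (_≡_; refl; sym; trans; cong; cong₂; subst₂; module ≡-Reasoning)
open import Relation.Nullary using (yes; no; contradiction)
open import Relation.Nullary.Decidable using (⌊_⌋)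

private variable
  A B : Set
  n j k : ℕ

-- Sums over lists

∑ : List A → (A → ℕ) → ℕ
∑ xs f = sum (map f xs)

∑-syntax : List A → (A → ℕ) → ℕ
∑-syntax = ∑

infixr 8 ∑-syntax
syntax ∑-syntax xs (λ x → e) = ∑[ x ∈ xs ] e

∑-cong : (xs : List A) {f g : A → ℕ} → (∀ a → f a ≡ g a) → ∑ xs f ≡ ∑ xs g
∑-cong []       f≗g = refl
∑-cong (x ∷ xs) f≗g = cong₂ _+_ (f≗g x) (∑-cong xs f≗g)

∑-mono-≤ : (xs : List A) {f g : A → ℕ} → (∀ a → f a ≤ g a) → ∑ xs f ≤ ∑ xs g
∑-mono-≤ []       f≤g = z≤n
∑-mono-≤ (x ∷ xs) f≤g = +-mono-≤ (f≤g x) (∑-mono-≤ xs f≤g)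

∑-distrib-+ : (xs : List A) (f g : A → ℕ) → ∑[ a ∈ xs ] (f a + g a) ≡ ∑ xs f + ∑ xs g
∑-distrib-+ []       f g = refl
∑-distrib-+ (x ∷ xs) f g rewrite ∑-distrib-+ xs f g = interchange (f x) (g x) (∑ xs f) (∑ xs g)
  where
  interchange : ∀ a b c d → a + b + (c + d) ≡ a + c + (b + d)
  interchange = solve-∀

*-distribˡ-∑ : (xs : List A) (c : ℕ) (f : A → ℕ) → ∑[ a ∈ xs ] (c * f a) ≡ c * ∑ xs f
*-distribˡ-∑ []       c f = sym (*-zeroʳ c)
*-distribˡ-∑ (x ∷ xs) c f rewrite *-distribˡ-∑ xs c f = sym (*-distribˡ-+ c (f x) (∑ xs f))

*-distribʳ-∑ : (xs : List A) (c : ℕ) (f : A → ℕ) → ∑[ a ∈ xs ] (f a * c) ≡ ∑ xs f * c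
*-distribʳ-∑ []       c f = refl
*-distribʳ-∑ (x ∷ xs) c f rewrite *-distribʳ-∑ xs c f = sym (*-distribʳ-+ c (f x) (∑ xs f))

∑-const : (xs : List A) (c : ℕ) → ∑[ _ ∈ xs ] c ≡ length xs * c
∑-const []       c = refl
∑-const (x ∷ xs) c = cong (c +_) (∑-const xs c)

∑-comm : (xs : List A) (ys : List B) (f : A → B → ℕ) →
         ∑[ a ∈ xs ] ∑[ b ∈ ys ] f a b ≡ ∑[ b ∈ ys ] ∑[ a ∈ xs ] f a b
∑-comm []       ys f = sym (trans (∑-const ys 0) (*-zeroʳ (length ys)))
∑-comm (x ∷ xs) ys f rewrite ∑-comm xs ys f = sym (∑-distrib-+ ys (f x) λ b → ∑[ a ∈ xs ] f a b)

∑-*-∑ : (xs : List A) (ys : List B) (f : A → ℕ) (g : B → ℕ) →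
        ∑[ a ∈ xs ] ∑[ b ∈ ys ] (f a * g b) ≡ ∑ xs f * ∑ ys g
∑-*-∑ xs ys f g = trans (∑-cong xs λ a → *-distribˡ-∑ ys (f a) g) (*-distribʳ-∑ xs (∑ ys g) f)

∑-++ : (xs ys : List A) (f : A → ℕ) → ∑ (xs ++ ys) f ≡ ∑ xs f + ∑ ys f
∑-++ xs ys f = trans (cong sum (map-++ f xs ys)) (sum-++ (map f xs) (map f ys))

∑-map : (xs : List A) (g : A → B) (f : B → ℕ) → ∑ (map g xs) f ≡ ∑[ a ∈ xs ] f (g a)
∑-map []       g f = refl
∑-map (x ∷ xs) g f = cong (f (g x) +_) (∑-map xs g f)

∑-concatMap : (xs : List A) (g : A → List B) (f : B → ℕ) →
              ∑ (concatMap g xs) f ≡ ∑[ a ∈ xs ] ∑ (g a) f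
∑-concatMap []       g f = refl
∑-concatMap (x ∷ xs) g f =
  trans (∑-++ (g x) (concatMap g xs) f) (cong (∑ (g x) f +_) (∑-concatMap xs g f))

-- With this indicator, count f is definitionally ∑[ v ∈ allFin n ] ⟦ f v ⟧.
⟦_⟧ : Bool → ℕ
⟦ b ⟧ = if b then 1 else 0

⟦∧⟧ : ∀ a b → ⟦ a ∧ b ⟧ ≡ ⟦ a ⟧ * ⟦ b ⟧
⟦∧⟧ true  b = sym (+-identityʳ ⟦ b ⟧)
⟦∧⟧ false b = refl

∑-filter : (p : A → Bool) (xs : List A) (f : A → ℕ) →
           ∑ (filter (λ x → p x Data.Bool.≟ true) xs) f ≡ ∑[ x ∈ xs ] (⟦ p x ⟧ * f x)
∑-filter p []       f = refl
∑-filter p (x ∷ xs) f with p x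
... | true  = cong₂ _+_ (sym (+-identityʳ (f x))) (∑-filter p xs f)
... | false = ∑-filter p xs f

-- Chebyshev's sum inequality and power means

-- (y − x)(g y − g x) ≥ 0, expanded with y = x + d and g y = g x + e.
rearrangement-≤ : (g : ℕ → ℕ) → Monotonic₁ _≤_ _≤_ g → ∀ {x y} → x ≤ y →
                  x * g y + y * g x ≤ x * g x + y * g y
rearrangement-≤ g mono {x} x≤y with m≤n⇒∃[o]m+o≡n x≤y | m≤n⇒∃[o]m+o≡n (mono x≤y)
... | d , refl | e , gx+e≡gy rewrite sym gx+e≡gy = begin
  x * (g x + e) + (x + d) * g x          ≤⟨ m≤m+n _ (d * e) ⟩
  x * (g x + e) + (x + d) * g x + d * e  ≡⟨ expand x d (g x) e ⟩
  x * g x + (x + d) * (g x + e)          ∎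
  where
  open ≤-Reasoning
  expand : ∀ x d p e → x * (p + e) + (x + d) * p + d * e ≡ x * p + (x + d) * (p + e)
  expand = solve-∀

rearrangement : (g : ℕ → ℕ) → Monotonic₁ _≤_ _≤_ g → ∀ x y →
                x * g y + y * g x ≤ x * g x + y * g y
rearrangement g mono x y with ≤-total x y
... | inj₁ x≤y = rearrangement-≤ g mono x≤y
... | inj₂ y≤x = subst₂ _≤_ (+-comm (y * g x) (x * g y)) (+-comm (y * g y) (x * g x))
                              (rearrangement-≤ g mono y≤x)

m+m≤n+n⇒m≤n : ∀ {m n} → m + m ≤ n + n → m ≤ n
m+m≤n+n⇒m≤n {m} {n} le with m ≤? n
... | yes m≤n = m≤n
... | no  m≰n = contradiction le (<⇒≱ (+-mono-< (≰⇒> m≰n) (≰⇒> m≰n)))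

∑-chebyshev : (xs : List A) (f : A → ℕ) (g : ℕ → ℕ) → Monotonic₁ _≤_ _≤_ g →
              ∑ xs f * ∑[ a ∈ xs ] g (f a) ≤ length xs * ∑[ a ∈ xs ] (f a * g (f a))
∑-chebyshev xs f g mono = m+m≤n+n⇒m≤n (begin
  P * Q + P * Q
    ≡⟨ cong₂ _+_ (sym (∑-*-∑ xs xs f h))
                 (sym (trans (∑-comm xs xs λ a b → f b * h a) (∑-*-∑ xs xs f h))) ⟩
  ∑[ a ∈ xs ] ∑[ b ∈ xs ] (f a * h b) + ∑[ a ∈ xs ] ∑[ b ∈ xs ] (f b * h a)
    ≡⟨ sym (∑∑-distrib-+ (λ a b → f a * h b) (λ a b → f b * h a)) ⟩
  ∑[ a ∈ xs ] ∑[ b ∈ xs ] (f a * h b + f b * h a)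
    ≤⟨ ∑-mono-≤ xs (λ a → ∑-mono-≤ xs λ b → rearrangement g mono (f a) (f b)) ⟩
  ∑[ a ∈ xs ] ∑[ b ∈ xs ] (f a * h a + f b * h b)
    ≡⟨ ∑∑-distrib-+ (λ a b → f a * h a) (λ a b → f b * h b) ⟩
  ∑[ a ∈ xs ] ∑[ b ∈ xs ] (f a * h a) + ∑[ a ∈ xs ] ∑[ b ∈ xs ] (f b * h b)
    ≡⟨ cong₂ _+_ (trans (∑-cong xs λ a → ∑-const xs (f a * h a)) (*-distribˡ-∑ xs L _))
                 (∑-const xs R) ⟩
  L * R + L * R ∎)
  where
  open ≤-Reasoning
  h : _ → ℕ
  h a = g (f a)
  P = ∑ xs f
  Q = ∑ xs h
  L = length xs
  R = ∑[ a ∈ xs ] (f a * h a)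
  ∑∑-distrib-+ : (u v : _ → _ → ℕ) → ∑[ a ∈ xs ] ∑[ b ∈ xs ] (u a b + v a b)
                 ≡ ∑[ a ∈ xs ] ∑[ b ∈ xs ] u a b + ∑[ a ∈ xs ] ∑[ b ∈ xs ] v a b
  ∑∑-distrib-+ u v = trans (∑-cong xs λ a → ∑-distrib-+ xs (u a) (v a)) (∑-distrib-+ xs _ _)

∑-power-mean : (xs : List A) (f : A → ℕ) (j : ℕ) →
               ∑ xs f ^ suc j ≤ length xs ^ j * ∑[ a ∈ xs ] f a ^ suc j
∑-power-mean xs f zero = ≤-reflexive (begin
  ∑ xs f * 1                  ≡⟨ *-identityʳ _ ⟩
  ∑ xs f                      ≡⟨ ∑-cong xs (λ a → sym (*-identityʳ (f a))) ⟩
  ∑[ a ∈ xs ] (f a * 1)       ≡⟨ sym (*-identityˡ _) ⟩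
  1 * ∑[ a ∈ xs ] (f a * 1)   ∎)
  where open ≡-Reasoning
∑-power-mean xs f (suc j) = begin
  P * P ^ suc j                                ≤⟨ *-monoʳ-≤ P (∑-power-mean xs f j) ⟩
  P * (L ^ j * ∑[ a ∈ xs ] f a ^ suc j)        ≡⟨ x*[y*z]≡y*[x*z] P (L ^ j) _ ⟩
  L ^ j * (P * ∑[ a ∈ xs ] f a ^ suc j)        ≤⟨ *-monoʳ-≤ (L ^ j) (∑-chebyshev xs f _ (^-monoˡ-≤ (suc j))) ⟩
  L ^ j * (L * ∑[ a ∈ xs ] f a ^ suc (suc j))  ≡⟨ x*[y*z]≡y*[x*z] (L ^ j) L _ ⟩
  L * (L ^ j * ∑[ a ∈ xs ] f a ^ suc (suc j))  ≡⟨ *-assoc L (L ^ j) _ ⟨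
  L ^ suc j * ∑[ a ∈ xs ] f a ^ suc (suc j)    ∎
  where
  open ≤-Reasoning
  P = ∑ xs f
  L = length xs
  x*[y*z]≡y*[x*z] : ∀ x y z → x * (y * z) ≡ y * (x * z)
  x*[y*z]≡y*[x*z] = solve-∀

-- Double counting

∑-allSeqs-suc : (f : Vec (Fin n) (suc k) → ℕ) →
                ∑ (allSeqs n (suc k)) f ≡ ∑[ v ∈ allFin n ] ∑[ T ∈ allSeqs n k ] f (v ∷ T)
∑-allSeqs-suc {n} {k} f =
  trans (∑-concatMap (allFin n) _ f) (∑-cong (allFin n) λ v → ∑-map (allSeqs n k) (v ∷_) f)

length-allSeqs : ∀ n k → length (allSeqs n k) ≡ n ^ k
length-allSeqs n zero    = refl
length-allSeqs n (suc k) = begin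
  length (allSeqs n (suc k))                    ≡⟨ length≡∑1 (allSeqs n (suc k)) ⟩
  ∑[ _ ∈ allSeqs n (suc k) ] 1                  ≡⟨ ∑-allSeqs-suc {n} {k} (λ _ → 1) ⟩
  ∑[ _ ∈ allFin n ] ∑[ _ ∈ allSeqs n k ] 1      ≡⟨ ∑-cong (allFin n) (λ _ → sym (length≡∑1 (allSeqs n k))) ⟩
  ∑[ _ ∈ allFin n ] length (allSeqs n k)        ≡⟨ ∑-const (allFin n) _ ⟩
  length (allFin n) * length (allSeqs n k)      ≡⟨ cong₂ _*_ (length-tabulate {n = n} id) (length-allSeqs n k) ⟩
  n * n ^ k                                     ∎
  where
  open ≡-Reasoning
  length≡∑1 : (xs : List A) → length xs ≡ ∑[ _ ∈ xs ] 1
  length≡∑1 xs = sym (trans (∑-const xs 1) (*-identityʳ (length xs)))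

allIn : (Fin n → Bool) → Vec (Fin n) k → Bool
allIn f []      = true
allIn f (t ∷ T) = f t ∧ allIn f T

count-^ : (f : Fin n → Bool) (k : ℕ) → count f ^ k ≡ ∑[ T ∈ allSeqs n k ] ⟦ allIn f T ⟧
count-^ f zero = refl
count-^ {n} f (suc k) = begin
  count f * count f ^ k
    ≡⟨ cong (count f *_) (count-^ f k) ⟩
  count f * ∑[ T ∈ allSeqs n k ] ⟦ allIn f T ⟧
    ≡⟨ sym (∑-*-∑ (allFin n) (allSeqs n k) (λ v → ⟦ f v ⟧) (λ T → ⟦ allIn f T ⟧)) ⟩
  ∑[ v ∈ allFin n ] ∑[ T ∈ allSeqs n k ] (⟦ f v ⟧ * ⟦ allIn f T ⟧)
    ≡⟨ ∑-cong (allFin n) (λ v → ∑-cong (allSeqs n k) λ T → sym (⟦∧⟧ (f v) (allIn f T))) ⟩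
  ∑[ v ∈ allFin n ] ∑[ T ∈ allSeqs n k ] ⟦ allIn f (v ∷ T) ⟧
    ≡⟨ sym (∑-allSeqs-suc (λ T → ⟦ allIn f T ⟧)) ⟩
  ∑[ T ∈ allSeqs n (suc k) ] ⟦ allIn f T ⟧ ∎
  where open ≡-Reasoning

allIn-true : (T : Vec (Fin n) k) → allIn (λ _ → true) T ≡ true
allIn-true []      = refl
allIn-true (t ∷ T) = allIn-true T

allIn-∧ : (f g : Fin n → Bool) (T : Vec (Fin n) k) →
          allIn (λ t → f t ∧ g t) T ≡ allIn f T ∧ allIn g T
allIn-∧ f g []      = refl
allIn-∧ f g (t ∷ T) rewrite allIn-∧ f g T = ∧-interchange (f t) (g t) (allIn f T) (allIn g T)

allIn-adj : (G : Graph n) (s : Fin n) (T : Vec (Fin n) k) → allIn (adj G s) T ≡ adjAll G T s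
allIn-adj G s []      = refl
allIn-adj G s (t ∷ T) rewrite allIn-adj G s T | adj-sym G s t = refl

allIn-adjAll-comm : (G : Graph n) (S : Vec (Fin n) j) (T : Vec (Fin n) k) →
                    allIn (adjAll G S) T ≡ allIn (adjAll G T) S
allIn-adjAll-comm G []      T = allIn-true T
allIn-adjAll-comm G (s ∷ S) T =
  trans (allIn-∧ (adj G s) (adjAll G S) T) (cong₂ _∧_ (allIn-adj G s T) (allIn-adjAll-comm G S T))

-- Both sides count the pairs (S, T) with every vertex of S adjacent to every vertex of T.
∑-commonNbrs-^-transpose : (G : Graph n) (Ss : List (Vec (Fin n) j)) (r : ℕ) →
  ∑[ S ∈ Ss ] commonNbrs G S ^ r ≡ ∑[ T ∈ allSeqs n r ] ∑[ S ∈ Ss ] ⟦ allIn (adjAll G T) S ⟧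
∑-commonNbrs-^-transpose {n} G Ss r = begin
  ∑[ S ∈ Ss ] commonNbrs G S ^ r
    ≡⟨ ∑-cong Ss (λ S → count-^ (adjAll G S) r) ⟩
  ∑[ S ∈ Ss ] ∑[ T ∈ allSeqs n r ] ⟦ allIn (adjAll G S) T ⟧
    ≡⟨ ∑-cong Ss (λ S → ∑-cong (allSeqs n r) λ T → cong ⟦_⟧ (allIn-adjAll-comm G S T)) ⟩
  ∑[ S ∈ Ss ] ∑[ T ∈ allSeqs n r ] ⟦ allIn (adjAll G T) S ⟧
    ≡⟨ ∑-comm Ss (allSeqs n r) _ ⟩
  ∑[ T ∈ allSeqs n r ] ∑[ S ∈ Ss ] ⟦ allIn (adjAll G T) S ⟧ ∎
  where open ≡-Reasoning

seqSum-comm : (G : Graph n) (j r : ℕ) → seqSum G j r ≡ seqSum G r j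
seqSum-comm {n} G j r = trans (∑-commonNbrs-^-transpose G (allSeqs n j) r)
                              (∑-cong (allSeqs n r) λ T → sym (count-^ (adjAll G T) j))

degPowSum≡∑commonNbrs : (G : Graph n) (r : ℕ) → degPowSum G r ≡ ∑[ T ∈ allSeqs n r ] commonNbrs G T
degPowSum≡∑commonNbrs {n} G r = begin
  degPowSum G r
    ≡⟨ ∑-cong (allFin n) (λ v → cong (_^ r) (degree≡commonNbrs v)) ⟩
  ∑[ v ∈ allFin n ] commonNbrs G (v ∷ []) ^ r
    ≡⟨ ∑-cong (allFin n) (λ v → sym (+-identityʳ _)) ⟩
  ∑[ v ∈ allFin n ] ∑[ T ∈ allSeqs n 0 ] commonNbrs G (v ∷ T) ^ r
    ≡⟨ sym (∑-allSeqs-suc (λ S → commonNbrs G S ^ r)) ⟩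
  seqSum G 1 r
    ≡⟨ seqSum-comm G 1 r ⟩
  ∑[ T ∈ allSeqs n r ] commonNbrs G T ^ 1
    ≡⟨ ∑-cong (allSeqs n r) (λ T → *-identityʳ _) ⟩
  ∑[ T ∈ allSeqs n r ] commonNbrs G T ∎
  where
  open ≡-Reasoning
  degree≡commonNbrs : ∀ v → degree G v ≡ commonNbrs G (v ∷ [])
  degree≡commonNbrs v = ∑-cong (allFin n) λ w → cong ⟦_⟧ (sym (∧-identityʳ (adj G v w)))

-- Sequences of distinct vertices

count-suc : (f : Fin (suc n) → Bool) → count f ≡ ⟦ f fzero ⟧ + count (λ v → f (fsuc v))
count-suc {n} f = cong (⟦ f fzero ⟧ +_)
  (trans (cong sum (map-tabulate fsuc λ v → ⟦ f v ⟧))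
         (sym (cong sum (map-tabulate id λ v → ⟦ f (fsuc v) ⟧))))

count-≟ : (y : Fin n) → count (λ v → ⌊ v ≟ y ⌋) ≡ 1
count-≟ {suc n} fzero = trans (count-suc {n} (λ v → ⌊ v ≟ fzero ⌋))
                              (cong suc (trans (∑-const (allFin n) 0) (*-zeroʳ (length (allFin n)))))
count-≟ {suc n} (fsuc y) = trans (count-suc {n} (λ v → ⌊ v ≟ fsuc y ⌋))
                                 (trans (∑-cong (allFin n) λ v → cong ⟦_⟧ (≟-fsuc v)) (count-≟ y))
  where
  ≟-fsuc : ∀ v → ⌊ fsuc v ≟ fsuc y ⌋ ≡ ⌊ v ≟ y ⌋
  ≟-fsuc v with v ≟ y
  ... | yes _ = refl
  ... | no  _ = refl

count-≤-avoid-one : (f : Fin n → Bool) (y : Fin n) → count f ≤ count (λ v → f v ∧ not ⌊ v ≟ y ⌋) + 1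
count-≤-avoid-one {n} f y = begin
  count f
    ≤⟨ ∑-mono-≤ (allFin n) (λ v → split (f v) ⌊ v ≟ y ⌋) ⟩
  ∑[ v ∈ allFin n ] (⟦ f v ∧ not ⌊ v ≟ y ⌋ ⟧ + ⟦ ⌊ v ≟ y ⌋ ⟧)
    ≡⟨ ∑-distrib-+ (allFin n) _ _ ⟩
  count (λ v → f v ∧ not ⌊ v ≟ y ⌋) + count (λ v → ⌊ v ≟ y ⌋)
    ≡⟨ cong (count (λ v → f v ∧ not ⌊ v ≟ y ⌋) +_) (count-≟ y) ⟩
  count (λ v → f v ∧ not ⌊ v ≟ y ⌋) + 1 ∎
  where
  open ≤-Reasoning
  split : ∀ a b → ⟦ a ⟧ ≤ ⟦ a ∧ not b ⟧ + ⟦ b ⟧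
  split true  true  = s≤s z≤n
  split true  false = s≤s z≤n
  split false b     = z≤n

count-≤-avoid : (f : Fin n → Bool) (S : Vec (Fin n) j) → count f ≤ count (λ v → f v ∧ notIn v S) + j
count-≤-avoid {n} f [] = ≤-reflexive (trans (∑-cong (allFin n) λ v → cong ⟦_⟧ (sym (∧-identityʳ (f v))))
                                        (sym (+-identityʳ _)))
count-≤-avoid {n} {suc j} f (y ∷ S) = begin
  count f                                         ≤⟨ count-≤-avoid-one f y ⟩
  count f′ + 1                                    ≤⟨ +-monoˡ-≤ 1 (count-≤-avoid f′ S) ⟩
  count (λ v → f′ v ∧ notIn v S) + j + 1          ≡⟨ +-assoc _ j 1 ⟩
  count (λ v → f′ v ∧ notIn v S) + (j + 1)        ≡⟨ cong₂ _+_ (∑-cong (allFin n) λ v → cong ⟦_⟧ (∧-assoc (f v) _ _))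
                                                               (+-comm j 1) ⟩
  count (λ v → f v ∧ notIn v (y ∷ S)) + suc j     ∎
  where
  open ≤-Reasoning
  f′ : _ → Bool
  f′ v = f v ∧ not ⌊ v ≟ y ⌋

countDistinct : (Fin n → Bool) → ℕ → ℕ
countDistinct {n} f j = ∑[ S ∈ allSeqs n j ] ⟦ distinct S ∧ allIn f S ⟧

countDistinct-suc : (f : Fin n → Bool) (j : ℕ) →
                    countDistinct f j * (count f ∸ j) ≤ countDistinct f (suc j)
countDistinct-suc {n} f j = begin
  countDistinct f j * (count f ∸ j)
    ≡⟨ sym (*-distribʳ-∑ (allSeqs n j) _ _) ⟩
  ∑[ S ∈ allSeqs n j ] (⟦ good S ⟧ * (count f ∸ j))
    ≤⟨ ∑-mono-≤ (allSeqs n j) (λ S → *-monoʳ-≤ ⟦ good S ⟧ (extensions S)) ⟩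
  ∑[ S ∈ allSeqs n j ] (⟦ good S ⟧ * count (λ v → f v ∧ notIn v S))
    ≡⟨ ∑-cong (allSeqs n j) (λ S → sym (*-distribˡ-∑ (allFin n) ⟦ good S ⟧ _)) ⟩
  ∑[ S ∈ allSeqs n j ] ∑[ v ∈ allFin n ] (⟦ good S ⟧ * ⟦ f v ∧ notIn v S ⟧)
    ≡⟨ sym (∑-comm (allFin n) (allSeqs n j) _) ⟩
  ∑[ v ∈ allFin n ] ∑[ S ∈ allSeqs n j ] (⟦ good S ⟧ * ⟦ f v ∧ notIn v S ⟧)
    ≡⟨ ∑-cong (allFin n) (λ v → ∑-cong (allSeqs n j) λ S → sym (good-∷ v S)) ⟩
  ∑[ v ∈ allFin n ] ∑[ S ∈ allSeqs n j ] ⟦ good (v ∷ S) ⟧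
    ≡⟨ sym (∑-allSeqs-suc (λ S → ⟦ good S ⟧)) ⟩
  countDistinct f (suc j) ∎
  where
  open ≤-Reasoning
  good : ∀ {k} → Vec (Fin n) k → Bool
  good S = distinct S ∧ allIn f S
  extensions : ∀ S → count f ∸ j ≤ count (λ v → f v ∧ notIn v S)
  extensions S = m≤n+o⇒m∸n≤o (count f) j (≤-trans (count-≤-avoid f S) (≤-reflexive (+-comm _ j)))
  good-∷ : ∀ v S → ⟦ good (v ∷ S) ⟧ ≡ ⟦ good S ⟧ * ⟦ f v ∧ notIn v S ⟧
  good-∷ v S = trans (cong ⟦_⟧ reorder) (⟦∧⟧ (good S) (f v ∧ notIn v S))
    where
    reorder : good (v ∷ S) ≡ good S ∧ (f v ∧ notIn v S)
    reorder = trans (∧-interchange (notIn v S) (distinct S) (f v) (allIn f S))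
                    (trans (∧-comm (notIn v S ∧ f v) (good S))
                           (cong (good S ∧_) (∧-comm (notIn v S) (f v))))

countDistinct-lower : (f : Fin n → Bool) {j k : ℕ} → j ≤ k → (count f ∸ k) ^ j ≤ countDistinct f j
countDistinct-lower f {zero}      _   = ≤-refl
countDistinct-lower f {suc j} {k} j<k = begin
  (count f ∸ k) * (count f ∸ k) ^ j  ≡⟨ *-comm (count f ∸ k) _ ⟩
  (count f ∸ k) ^ j * (count f ∸ k)  ≤⟨ *-mono-≤ (countDistinct-lower f j≤k) (∸-monoʳ-≤ (count f) j≤k) ⟩
  countDistinct f j * (count f ∸ j)  ≤⟨ countDistinct-suc f j ⟩
  countDistinct f (suc j)            ∎
  where
  open ≤-Reasoning
  j≤k = <⇒≤ j<k

distinctSeqSum≡∑countDistinct : (G : Graph n) (j r : ℕ) →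
                                distinctSeqSum G j r ≡ ∑[ T ∈ allSeqs n r ] countDistinct (adjAll G T) j
distinctSeqSum≡∑countDistinct {n} G j r = begin
  distinctSeqSum G j r
    ≡⟨ ∑-commonNbrs-^-transpose G (distinctSeqs n j) r ⟩
  ∑[ T ∈ allSeqs n r ] ∑[ S ∈ distinctSeqs n j ] ⟦ allIn (adjAll G T) S ⟧
    ≡⟨ ∑-cong (allSeqs n r) (λ T → ∑-filter distinct (allSeqs n j) _) ⟩
  ∑[ T ∈ allSeqs n r ] ∑[ S ∈ allSeqs n j ] (⟦ distinct S ⟧ * ⟦ allIn (adjAll G T) S ⟧)
    ≡⟨ ∑-cong (allSeqs n r) (λ T → ∑-cong (allSeqs n j) λ S → sym (⟦∧⟧ (distinct S) _)) ⟩
  ∑[ T ∈ allSeqs n r ] countDistinct (adjAll G T) j ∎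
  where open ≡-Reasoning

∑[commonNbrs∸j]^j≤distinctSeqSum : (G : Graph n) (j r : ℕ) →
  ∑[ T ∈ allSeqs n r ] (commonNbrs G T ∸ j) ^ j ≤ distinctSeqSum G j r
∑[commonNbrs∸j]^j≤distinctSeqSum {n} G j r = begin
  ∑[ T ∈ allSeqs n r ] (commonNbrs G T ∸ j) ^ j
    ≤⟨ ∑-mono-≤ (allSeqs n r) (λ T → countDistinct-lower (adjAll G T) {j} ≤-refl) ⟩
  ∑[ T ∈ allSeqs n r ] countDistinct (adjAll G T) j
    ≡⟨ distinctSeqSum≡∑countDistinct G j r ⟨
  distinctSeqSum G j r ∎
  where open ≤-Reasoning

power-mean-allSeqs : (n r j : ℕ) .{{_ : NonZero j}} (f : Vec (Fin n) r → ℕ) →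
  n ^ (j + r) * ∑ (allSeqs n r) f ^ j ≤ ∑[ T ∈ allSeqs n r ] f T ^ j * n ^ ((r + 1) * j)
power-mean-allSeqs n r (suc j) f = begin
  n ^ (suc j + r) * ∑ Ts f ^ suc j           ≤⟨ *-monoʳ-≤ (n ^ (suc j + r)) (∑-power-mean Ts f j) ⟩
  n ^ (suc j + r) * (length Ts ^ j * X)      ≡⟨ cong (λ m → n ^ (suc j + r) * (m ^ j * X)) (length-allSeqs n r) ⟩
  n ^ (suc j + r) * ((n ^ r) ^ j * X)        ≡⟨ cong (λ m → n ^ (suc j + r) * (m * X)) (^-*-assoc n r j) ⟩
  n ^ (suc j + r) * (n ^ (r * j) * X)        ≡⟨ x*[y*z]≡z*[x*y] (n ^ (suc j + r)) _ X ⟩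
  X * (n ^ (suc j + r) * n ^ (r * j))        ≡⟨ cong (X *_) (^-distribˡ-+-* n (suc j + r) (r * j)) ⟨
  X * n ^ (suc j + r + r * j)                ≡⟨ cong (λ e → X * n ^ e) (exponent j r) ⟩
  X * n ^ ((r + 1) * suc j)                  ∎
  where
  open ≤-Reasoning
  Ts = allSeqs n r
  X = ∑[ T ∈ Ts ] f T ^ suc j
  x*[y*z]≡z*[x*y] : ∀ x y z → x * (y * z) ≡ z * (x * y)
  x*[y*z]≡z*[x*y] = solve-∀
  exponent : ∀ j r → suc j + r + r * j ≡ (r + 1) * suc j
  exponent = solve-∀

seqSum-lower : (G : Graph n) (j r : ℕ) .{{_ : NonZero j}} →
               n ^ (j + r) * degPowSum G r ^ j ≤ seqSum G j r * n ^ ((r + 1) * j)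
seqSum-lower {n} G j r = begin
  n ^ (j + r) * degPowSum G r ^ j                   ≡⟨ cong (λ D → n ^ (j + r) * D ^ j) (degPowSum≡∑commonNbrs G r) ⟩
  n ^ (j + r) * ∑ (allSeqs n r) (commonNbrs G) ^ j  ≤⟨ power-mean-allSeqs n r j (commonNbrs G) ⟩
  seqSum G r j * n ^ ((r + 1) * j)                  ≡⟨ cong (_* n ^ ((r + 1) * j)) (seqSum-comm G r j) ⟩
  seqSum G j r * n ^ ((r + 1) * j)                  ∎
  where open ≤-Reasoning

m≤m^n : ∀ m n .{{_ : NonZero n}} → m ≤ m ^ n
m≤m^n zero    n       = z≤n
m≤m^n (suc m) (suc n) = m≤m*n (suc m) (suc m ^ n) {{m^n≢0 (suc m) n}}

m≤a+b⇒2a≤m⇒m≤2b : ∀ {m a b} → m ≤ a + b → 2 * a ≤ m → m ≤ 2 * b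
m≤a+b⇒2a≤m⇒m≤2b {m} {a} {b} m≤a+b 2a≤m = +-cancelˡ-≤ m m (2 * b) (begin
  m + m              ≤⟨ +-mono-≤ m≤a+b m≤a+b ⟩
  a + b + (a + b)    ≡⟨ double-sum a b ⟩
  2 * a + 2 * b      ≤⟨ +-monoˡ-≤ (2 * b) 2a≤m ⟩
  m + 2 * b          ∎)
  where
  open ≤-Reasoning
  double-sum : ∀ a b → a + b + (a + b) ≡ 2 * a + 2 * b
  double-sum = solve-∀

-- Truncating every |N(T)| by j loses at most n^r j, and the hypothesis makes 2 n^r j ≤ D.
degPowSum≤2*∑[commonNbrs∸j] : (G : Graph n) (j r : ℕ) .{{_ : NonZero r}} →
  (4 * j) ^ r * n ^ r < degPowSum G r → degPowSum G r ≤ 2 * ∑[ T ∈ allSeqs n r ] (commonNbrs G T ∸ j)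
degPowSum≤2*∑[commonNbrs∸j] {n} G j r large = m≤a+b⇒2a≤m⇒m≤2b {a = n ^ r * j} truncation slack
  where
  open ≤-Reasoning
  Ts = allSeqs n r
  D = degPowSum G r
  truncation : D ≤ n ^ r * j + ∑[ T ∈ Ts ] (commonNbrs G T ∸ j)
  truncation = begin
    D                                             ≡⟨ degPowSum≡∑commonNbrs G r ⟩
    ∑ Ts (commonNbrs G)                           ≤⟨ ∑-mono-≤ Ts (λ T → m≤n+m∸n (commonNbrs G T) j) ⟩
    ∑[ T ∈ Ts ] (j + (commonNbrs G T ∸ j))        ≡⟨ ∑-distrib-+ Ts (λ _ → j) _ ⟩
    ∑[ _ ∈ Ts ] j + ∑[ T ∈ Ts ] (commonNbrs G T ∸ j)
      ≡⟨ cong (_+ ∑[ T ∈ Ts ] (commonNbrs G T ∸ j)) (trans (∑-const Ts j) (cong (_* j) (length-allSeqs n r))) ⟩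
    n ^ r * j + ∑[ T ∈ Ts ] (commonNbrs G T ∸ j)  ∎
  slack : 2 * (n ^ r * j) ≤ D
  slack = begin
    2 * (n ^ r * j)    ≡⟨ x*[y*z]≡x*z*y 2 (n ^ r) j ⟩
    2 * j * n ^ r      ≤⟨ *-monoˡ-≤ (n ^ r) (*-monoˡ-≤ j {2} {4} (s≤s (s≤s z≤n))) ⟩
    4 * j * n ^ r      ≤⟨ *-monoˡ-≤ (n ^ r) (m≤m^n (4 * j) r) ⟩
    (4 * j) ^ r * n ^ r <⟨ large ⟩
    D                  ∎
    where
    x*[y*z]≡x*z*y : ∀ x y z → x * (y * z) ≡ x * z * y
    x*[y*z]≡x*z*y = solve-∀

^-distribʳ-* : ∀ m n k → (m * n) ^ k ≡ m ^ k * n ^ k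
^-distribʳ-* m n zero    = refl
^-distribʳ-* m n (suc k) rewrite ^-distribʳ-* m n k = interchange m n (m ^ k) (n ^ k)
  where
  interchange : ∀ a b c d → a * b * (c * d) ≡ a * c * (b * d)
  interchange = solve-∀

distinctSeqSum-lower : (G : Graph n) (j r : ℕ) .{{_ : NonZero j}} .{{_ : NonZero r}} →
  (4 * j) ^ r * n ^ r < degPowSum G r →
  n ^ (j + r) * degPowSum G r ^ j ≤ 2 ^ (j + 1) * distinctSeqSum G j r * n ^ ((r + 1) * j)
distinctSeqSum-lower {n} G j r large = begin
  n ^ (j + r) * D ^ j                     ≤⟨ *-monoʳ-≤ (n ^ (j + r)) (^-monoˡ-≤ j (degPowSum≤2*∑[commonNbrs∸j] G j r large)) ⟩
  n ^ (j + r) * (2 * Y) ^ j               ≡⟨ cong (n ^ (j + r) *_) (^-distribʳ-* 2 Y j) ⟩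
  n ^ (j + r) * (2 ^ j * Y ^ j)           ≡⟨ x*[y*z]≡y*[x*z] (n ^ (j + r)) (2 ^ j) (Y ^ j) ⟩
  2 ^ j * (n ^ (j + r) * Y ^ j)           ≤⟨ *-monoʳ-≤ (2 ^ j) (power-mean-allSeqs n r j excess) ⟩
  2 ^ j * (∑[ T ∈ Ts ] excess T ^ j * E)  ≤⟨ *-monoʳ-≤ (2 ^ j) (*-monoˡ-≤ E (∑[commonNbrs∸j]^j≤distinctSeqSum G j r)) ⟩
  2 ^ j * (Dist * E)                         ≤⟨ *-monoˡ-≤ (Dist * E) (^-monoʳ-≤ 2 (m≤m+n j 1)) ⟩
  2 ^ (j + 1) * (Dist * E)                   ≡⟨ *-assoc (2 ^ (j + 1)) Dist E ⟨
  2 ^ (j + 1) * Dist * E                     ∎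
  where
  open ≤-Reasoning
  Ts = allSeqs n r
  D = degPowSum G r
  Dist = distinctSeqSum G j r
  E = n ^ ((r + 1) * j)
  excess : Vec (Fin n) r → ℕ
  excess T = commonNbrs G T ∸ j
  Y = ∑ Ts excess
  x*[y*z]≡y*[x*z] : ∀ x y z → x * (y * z) ≡ y * (x * z)
  x*[y*z]≡y*[x*z] = solve-∀

lemma3p5 : (n : ℕ) (G : Graph n) (j r : ℕ) → .{{NonZero j}} → .{{NonZero r}} →
           (n ^ (j + r) * degPowSum G r ^ j ≤ seqSum G j r * n ^ ((r + 1) * j))
           × ((4 * j) ^ r * n ^ r < degPowSum G r →
              n ^ (j + r) * degPowSum G r ^ j ≤ 2 ^ (j + 1) * distinctSeqSum G j r * n ^ ((r + 1) * j))
lemma3p5 n G j r = seqSum-lower G j r , distinctSeqSum-lower G j r
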